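{- Let $R$ be a skeleton and let $e_1,e_2$ be edges of $R$. Then there exists a cycle of $R$ that goes through $e_1$ and $e_2$, or there exists a path in $R$ whose two end-vertices have degree 1 in $R$ and that goes through $e_1$ and $e_2$.
   Context: All graphs are finite and simple; a graph is chordless if no cycle of it has a chord. A skeleton is a $k$-skeleton for some integer $k\ge1$, defined as follows. In a graph $R$, a branch vertex is a vertex of degree at least 3; an edge is pendant if at least one endnode has degree 1. A branch is a path of length at least 1 whose internal vertices have degree 2 in $R$ and whose two endnodes are branch vertices; a limb is a path of length at least 1 whose internal vertices have degree 2 in $R$, with one endnode of degree at least 3 and the other of degree 1. Two distinct branches are parallel if they have the same endnodes; two distinct limbs are parallel if they share their endnode of degree at least 3. An attaching vertex is a cut vertex of degree at least 3. For an attaching vertex $x$, let $C_1,\dots,C_t$ be the components of $R-x$ that together with $x$ do not form limbs of $R$; the $x$-petals of $R$ are the graphs $R[V(C_i)\cup\{x\}]$ and, if $x$ is the end of at least two parallel limbs, also the subgraph formed by all limbs of $R$ with endnode $x$. A $k$-skeleton is a graph $R$ such that: (i) $R$ is connected, triangle-free, chordless and has at least three pendant edges; (ii) $R$ has no parallel branches; (iii) for every cut vertex $u$, every component of $R-u$ has a vertex of degree 1 in $R$; (iv) for every vertex cutset $S=\{a,b\}$ and every component $C$ of $R\setminus S$, either $R[C\cup S]$ is a chordless path from $a$ to $b$ or $C$ contains a vertex of degree 1 in $R$; (v) for every edge of a cycle of $R$, at least one endnode has degree 2; (vi) each pendant edge gets one label from $\{1,\dots,k\}$; (vii) every label is used at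 least once and some label is used at least twice; (viii) if a pendant edge with an endnode of degree at least 3 gets label $i$, then no other pendant edge gets label $i$; (ix) if $R$ has no branches then $k=1$, and otherwise, whenever two limbs are parallel, their pendant edges get different labels and at least one of these labels is used more than once; (x) if $k>1$, then for every attaching vertex $x$ and every $x$-petal $H$, at least two distinct labels are used on pendant edges of $H$, and if $\overline H$ is a union of at least one but not all $x$-petals, some label $i$ is used on pendant edges of both $\overline H$ and $(R\setminus\overline H)\cup\{x\}$; (xi) if $k=2$ then both labels are used at least twice. -}

module Defs where

open import Data.Nat using (ℕ; zero; suc; _≤_; _<_)
open import Data.Fin using (Fin)
open import Data.Bool using (Bool; true; false; not; _∨_; if_then_else_)
open import Data.List using (List; []; _∷_; _++_; [_]; length; head; last; map; allFin; take)
open import Data.Nat.ListAction using (sum)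
open import Data.List.Membership.Propositional using (_∈_)
open import Data.List.Relation.Unary.Linked using (Linked)
open import Data.List.Relation.Unary.Unique.Propositional using (Unique)
open import Data.List.Relation.Unary.All using (All)
open import Data.Maybe using (Maybe; just)
open import Data.Product using (Σ; ∃; ∃₂; _×_; _,_)
open import Data.Sum using (_⊎_)
open import Data.Empty using (⊥)
open import Relation.Nullary using (¬_)
open import Relation.Nullary.Decidable using (⌊_⌋)
open import Relation.Binary.PropositionalEquality using (_≡_; _≢_)
open import Function.Bundles using (_⇔_)
import Data.Fin as F

record Graph : Set where
  field
    n      : ℕ
    adj    : Fin n → Fin n → Bool
    sym    : ∀ u v → adj u v ≡ adj v u
    irrefl : ∀ v → adj v v ≡ false

module _ (G : Graph) where
  open Graph G

  V : Set
  V = Fin n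

  E : V → V → Set
  E u v = adj u v ≡ true

  deg : V → ℕ
  deg v = sum (map (λ u → if adj v u then 1 else 0) (allFin n))

  VSet : Set
  VSet = V → Bool

  IsPath : List V → Set
  IsPath vs = Linked E vs × Unique vs

  PathFromTo : V → V → List V → Set
  PathFromTo a b vs = IsPath vs × head vs ≡ just a × last vs ≡ just b

  Consec : V → V → List V → Set
  Consec u v vs = ∃₂ λ xs ys → vs ≡ xs ++ u ∷ v ∷ ys

  EdgeOfPath : V → V → List V → Set
  EdgeOfPath u v vs = Consec u v vs ⊎ Consec v u vs

  Inner : V → List V → Set
  Inner v vs = ∃₂ λ x xs → ∃₂ λ y ys → vs ≡ x ∷ xs ++ v ∷ ys ++ [ y ]

  IsCycle : List V → Set
  IsCycle vs = IsPath vs × 3 ≤ length vs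
             × (∀ a b → head vs ≡ just a → last vs ≡ just b → E b a)

  -- {u,v} is an edge of the cycle vs (closing edge included)
  EdgeOfCycle : V → V → List V → Set
  EdgeOfCycle u v vs = EdgeOfPath u v (vs ++ take 1 vs)

  Connected : Set
  Connected = ∀ a b → Σ (List V) (PathFromTo a b)

  TriangleFree : Set
  TriangleFree = ∀ a b c → E a b → E b c → E a c → ⊥

  Chordless : Set
  Chordless = ∀ vs → IsCycle vs → ∀ u v → u ∈ vs → v ∈ vs → E u v → EdgeOfCycle u v vs

  data Reach (X : V → Set) : V → V → Set where
    here : ∀ {a} → ¬ X a → Reach X a a
    step : ∀ {a b c} → ¬ X a → E a b → Reach X b c → Reach X a c

  NoVertex : V → Set
  NoVertex _ = ⊥

  CutVertex : V → Set
  CutVertex u = ∃₂ λ a b → a ≢ u × b ≢ u × Reach NoVertex a b × ¬ Reach (_≡ u) a b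

  Pair : V → V → V → Set
  Pair a b v = v ≡ a ⊎ v ≡ b

  Cutset2 : V → V → Set
  Cutset2 a b = a ≢ b × (∃₂ λ p q → ¬ Pair a b p × ¬ Pair a b q × ¬ Reach (Pair a b) p q)

  Pendant : V → V → Set
  Pendant u v = E u v × (deg u ≡ 1 ⊎ deg v ≡ 1)

  SameEdge : V → V → V → V → Set
  SameEdge u v u' v' = (u ≡ u' × v ≡ v') ⊎ (u ≡ v' × v ≡ u')

  IsBranchVertex : V → Set
  IsBranchVertex v = 3 ≤ deg v

  BranchFromTo : V → V → List V → Set
  BranchFromTo a b vs = PathFromTo a b vs × 2 ≤ length vs
                      × (∀ v → Inner v vs → deg v ≡ 2)
                      × IsBranchVertex a × IsBranchVertex b

  IsBranch : List V → Set
  IsBranch vs = ∃₂ λ a b → BranchFromTo a b vs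

  -- limb, listed from its end x of degree ≥ 3 to its end of degree 1
  LimbFrom : V → List V → Set
  LimbFrom x vs = ∃ λ y → PathFromTo x y vs × 2 ≤ length vs
                × (∀ v → Inner v vs → deg v ≡ 2)
                × 3 ≤ deg x × deg y ≡ 1

  -- the last edge of a list (the pendant edge of a limb)
  EndEdge : List V → V → V → Set
  EndEdge vs u v = ∃ λ xs → vs ≡ xs ++ u ∷ v ∷ []

  HasParallelLimbs : V → Set
  HasParallelLimbs x = ∃₂ λ vs ws → LimbFrom x vs × LimbFrom x ws × vs ≢ ws

  AttachingVertex : V → Set
  AttachingVertex x = CutVertex x × 3 ≤ deg x

  FormsLimb : V → V → Set
  FormsLimb x c = ∃ λ vs → LimbFrom x vs × (∀ v → (v ∈ vs) ⇔ (v ≡ x ⊎ Reach (_≡ x) c v))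

  -- H (a vertex set; petals are induced subgraphs) is an x-petal
  IsPetal : V → VSet → Set
  IsPetal x H =
      (∃ λ c → c ≢ x × ¬ FormsLimb x c × (∀ v → (H v ≡ true) ⇔ (v ≡ x ⊎ Reach (_≡ x) c v)))
    ⊎ (HasParallelLimbs x × (∀ v → (H v ≡ true) ⇔ (∃ λ vs → LimbFrom x vs × v ∈ vs)))

  SameSet : VSet → VSet → Set
  SameSet H K = ∀ v → H v ≡ K v

  PetalUnion : V → VSet → Set₁
  PetalUnion x Hb = Σ (VSet → Set) λ S →
      (∀ P → S P → IsPetal x P)
    × (∃ λ P → S P)
    × (∃ λ P → IsPetal x P × (∀ Q → S Q → ¬ SameSet Q P))
    × (∀ v → (Hb v ≡ true) ⇔ (∃ λ P → S P × P v ≡ true))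

  ComplPlus : V → VSet → VSet
  ComplPlus x Hb v = not (Hb v) ∨ ⌊ v F.≟ x ⌋

  -- labelled skeleta. Labels {1,…,k} are represented by Fin k.

  module Labelled (k : ℕ) (lab : V → V → Fin k) where

    UsedOn : VSet → Fin k → Set
    UsedOn H i = ∃₂ λ u v → Pendant u v × H u ≡ true × H v ≡ true × lab u v ≡ i

    UsedOnce : Fin k → Set
    UsedOnce i = ∃₂ λ u v → Pendant u v × lab u v ≡ i

    UsedTwice : Fin k → Set
    UsedTwice i = ∃₂ λ u v → ∃₂ λ u' v' → Pendant u v × Pendant u' v'
                × ¬ SameEdge u v u' v' × lab u v ≡ i × lab u' v' ≡ i

    record SkeletonConditions : Set₁ where
      field
        connected    : Connected
        triangleFree : TriangleFree
        chordless    : Chordless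
        threePendant : ∃₂ λ a b → ∃₂ λ c d → ∃₂ λ e f →
                         Pendant a b × Pendant c d × Pendant e f
                       × ¬ SameEdge a b c d × ¬ SameEdge a b e f × ¬ SameEdge c d e f
        noParallelBranches : ∀ a b vs ws → BranchFromTo a b vs → BranchFromTo a b ws → vs ≡ ws
        cutVertexCond : ∀ u → CutVertex u → ∀ w → w ≢ u →
                          ∃ λ v → Reach (_≡ u) w v × deg v ≡ 1
        cutsetCond : ∀ a b → Cutset2 a b → ∀ c → ¬ Pair a b c →
                       (∃ λ vs → PathFromTo a b vs
                          × (∀ v → (v ∈ vs) ⇔ (Pair a b v ⊎ Reach (Pair a b) c v))
                          × (∀ u v → u ∈ vs → v ∈ vs → E u v → EdgeOfPath u v vs))
                     ⊎ (∃ λ v → Reach (Pair a b) c v × deg v ≡ 1)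
        cycleEdgeCond : ∀ vs → IsCycle vs → ∀ u v → EdgeOfCycle u v vs → deg u ≡ 2 ⊎ deg v ≡ 2
        -- (vi) each pendant edge gets one label
        labelSym : ∀ u v → Pendant u v → lab u v ≡ lab v u
        allUsed : ∀ i → UsedOnce i
        someTwice : ∃ λ i → UsedTwice i
        bigEndUnique : ∀ u v → Pendant u v → (3 ≤ deg u ⊎ 3 ≤ deg v) →
                         ∀ u' v' → Pendant u' v' → lab u' v' ≡ lab u v → SameEdge u v u' v'
        noBranchK1 : (∀ vs → ¬ IsBranch vs) → k ≡ 1
        parallelLimbs : (∃ λ vs → IsBranch vs) →
                          ∀ x vs ws → LimbFrom x vs → LimbFrom x ws → vs ≢ ws →
                          ∀ u v u' v' → EndEdge vs u v → EndEdge ws u' v' →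
                          lab u v ≢ lab u' v' × (UsedTwice (lab u v) ⊎ UsedTwice (lab u' v'))
        petalCond : 1 < k → ∀ x → AttachingVertex x →
                      (∀ H → IsPetal x H → ∃₂ λ i j → i ≢ j × UsedOn H i × UsedOn H j)
                    × (∀ Hb → PetalUnion x Hb → ∃ λ i → UsedOn Hb i × UsedOn (ComplPlus x Hb) i)
        k2Cond : k ≡ 2 → ∀ i → UsedTwice i

  IsSkeleton : Set₁
  IsSkeleton = Σ ℕ λ k → 1 ≤ k × Σ (V → V → Fin k) λ lab → Labelled.SkeletonConditions k lab

module Submission where

open import Defs
open import Data.List using (List; head; last)
open import Data.Maybe using (just)
open import Data.Product using (Σ; ∃; ∃₂; _×_)
open import Data.Sum using (_⊎_)
open import Relation.Binary.PropositionalEquality using (_≡_)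

open import Data.Bool using (Bool; true; false; if_then_else_)
import Data.Bool.Properties as Bool
open import Data.Empty using (⊥-elim)
open import Data.Fin using (Fin; zero; suc; _≟_)
open import Data.Fin.Properties using (suc-injective)
open import Data.List using ([]; _∷_; _++_; [_]; length; map; reverse; take; allFin; filter)
open import Data.List.Properties
  using ( ++-assoc; unfold-reverse; reverse-++; map-++; length-map; length-reverse; length-++-≤ʳ
        ; last-map; filter-notAll )
open import Data.List.Membership.Propositional using (_∈_; _∉_)
open import Data.List.Membership.Propositional.Properties
  using (∈-∃++; ∈-++⁺ˡ; ∈-++⁻; ∈-allFin; ∈-filter⁺; ∈-filter⁻)
open import Data.List.Relation.Unary.All using (All; []; _∷_; lookup)
open import Data.List.Relation.Unary.All.Properties using (¬Any⇒All¬)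
import Data.List.Relation.Unary.All.Properties as Allₚ
open import Data.List.Relation.Unary.AllPairs using ([]; _∷_)
open import Data.List.Relation.Unary.Any using (here; there; any?; satisfied)
import Data.List.Relation.Unary.Any as Any
open import Data.List.Relation.Unary.Linked using (Linked; []; [-]; _∷_)
import Data.List.Relation.Unary.Linked as Linked
import Data.List.Relation.Unary.Linked.Properties as Linkedₚ
open import Data.List.Relation.Unary.Unique.Propositional using (Unique)
open import Data.List.Relation.Unary.Unique.Propositional.Properties using (Unique[x∷xs]⇒x∉xs; allFin⁺)
import Data.List.Relation.Unary.Unique.Propositional.Properties as Uniqueₚ
open import Data.List.Relation.Binary.Permutation.Propositional
  using (_↭_; ↭-refl; ↭-sym; ↭⇒↭ₛ; module PermutationReasoning)
open import Data.List.Relation.Binary.Permutation.Propositional.Properties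
  using (++-comm; ++⁺ʳ; ↭-length; ↭-reverse; ∈-resp-↭)
import Data.List.Relation.Binary.Permutation.Setoid.Properties as ↭ₛ
import Data.Maybe as Maybe
open import Data.Maybe.Relation.Binary.Connected using (just) renaming (Connected to Connectedᵐ)
open import Data.Nat using (ℕ; zero; suc; _≤_; z≤n; s≤s) renaming (_≟_ to _≟ⁿ_)
open import Data.Nat.ListAction using (sum)
open import Data.Nat.Properties using (≤-refl; ≤-trans; ≤-pred; m≤n+m)
open import Data.Product using (_,_; proj₁; proj₂)
import Data.Product as Product
open import Data.Sum using (inj₁; inj₂)
import Data.Sum as Sum
open import Function using (id; _∘_)
open import Relation.Binary.Core using (Rel)
open import Relation.Binary.Definitions using (Symmetric; DecidableEquality)
open import Relation.Binary.PropositionalEquality using (_≢_; refl; sym; trans; cong; subst; setoid)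
open import Relation.Nullary using (¬_; Dec; yes; no; does; ¬?; _×-dec_)
open import Relation.Nullary.Decidable using (dec-true)

-- Add to R an apex joined to every leaf.  The resulting graph R⁺ has no cut
-- vertex: R is connected, and after deleting a vertex w of R every other vertex
-- still reaches a leaf different from w (by condition (iii) when w is a cut
-- vertex of R), hence the apex.  In a graph with at least three vertices and no
-- cut vertex any two edges lie on a common cycle: take a cycle through the first
-- edge and, walking towards the second, repeatedly replace the arc not carrying
-- the first edge by an ear.  A cycle of R⁺ through two edges of R is a cycle of
-- R if it avoids the apex; otherwise deleting the apex leaves a path of R
-- joining two leaves.

module Lists where

  private variable
    A B : Set
    u v w x y : A
    xs ys : List A

  data Consecutive (u v : A) : List A → Set where
    here  : Consecutive u v (u ∷ v ∷ xs)
    there : Consecutive u v xs → Consecutive u v (x ∷ xs)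

  Adjacent : A → A → List A → Set
  Adjacent u v xs = Consecutive u v xs ⊎ Consecutive v u xs

  Consecutive⇒∃++ : Consecutive u v xs → ∃₂ λ ys zs → xs ≡ ys ++ u ∷ v ∷ zs
  Consecutive⇒∃++ (here {xs = zs}) = [] , zs , refl
  Consecutive⇒∃++ (there {x = x} c) with ys , zs , refl ← Consecutive⇒∃++ c = x ∷ ys , zs , refl

  Consecutive⇒∈ : Consecutive u v xs → u ∈ xs × v ∈ xs
  Consecutive⇒∈ here      = here refl , there (here refl)
  Consecutive⇒∈ (there c) = Product.map there there (Consecutive⇒∈ c)

  Consecutive-++⁺ˡ : ∀ ys → Consecutive u v xs → Consecutive u v (xs ++ ys)
  Consecutive-++⁺ˡ ys here      = here
  Consecutive-++⁺ˡ ys (there c) = there (Consecutive-++⁺ˡ ys c)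

  Consecutive-++⁺ʳ : ∀ xs → Consecutive u v ys → Consecutive u v (xs ++ ys)
  Consecutive-++⁺ʳ []       c = c
  Consecutive-++⁺ʳ (x ∷ xs) c = there (Consecutive-++⁺ʳ xs c)

  Consecutive-++⁻ : ∀ xs {ys} → Consecutive u v (xs ++ w ∷ ys) →
                    Consecutive u v (xs ++ [ w ]) ⊎ Consecutive u v (w ∷ ys)
  Consecutive-++⁻ []           c         = inj₂ c
  Consecutive-++⁻ (x ∷ [])     here      = inj₁ here
  Consecutive-++⁻ (x ∷ [])     (there c) = inj₂ c
  Consecutive-++⁻ (x ∷ y ∷ xs) here      = inj₁ here
  Consecutive-++⁻ (x ∷ y ∷ xs) (there c) = Sum.map₁ there (Consecutive-++⁻ (y ∷ xs) c)

  Consecutive-reverse⁺ : Consecutive u v xs → Consecutive v u (reverse xs)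
  Consecutive-reverse⁺ {u = u} {v} (here {xs = xs}) =
    subst (Consecutive v u) (sym (reverse-++ (u ∷ v ∷ []) xs)) (Consecutive-++⁺ʳ (reverse xs) here)
  Consecutive-reverse⁺ (there {xs = xs} {x = x} c) =
    subst (Consecutive _ _) (sym (unfold-reverse x xs)) (Consecutive-++⁺ˡ [ x ] (Consecutive-reverse⁺ c))

  Consecutive-∷⁻ : Consecutive u v (x ∷ xs) → u ≢ x → Consecutive u v xs
  Consecutive-∷⁻ here      u≢x = ⊥-elim (u≢x refl)
  Consecutive-∷⁻ (there c) _   = c

  Consecutive-∷ʳ⁻ : ∀ xs → Consecutive u v (xs ++ [ x ]) → v ≢ x → Consecutive u v xs
  Consecutive-∷ʳ⁻ []           (there ()) _
  Consecutive-∷ʳ⁻ (y ∷ [])     here       v≢x = ⊥-elim (v≢x refl)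
  Consecutive-∷ʳ⁻ (y ∷ z ∷ xs) here       _   = here
  Consecutive-∷ʳ⁻ (y ∷ xs)     (there c)  v≢x = there (Consecutive-∷ʳ⁻ xs c v≢x)

  Consecutive-map⁻ : {f : A → B} → (∀ {a b} → f a ≡ f b → a ≡ b) →
                     ∀ xs → Consecutive (f u) (f v) (map f xs) → Consecutive u v xs
  Consecutive-map⁻ {u = u} {v} {f = f} f-inj xs c = go xs c refl refl
    where
    go : ∀ {u′ v′} xs → Consecutive u′ v′ (map f xs) → u′ ≡ f u → v′ ≡ f v →
         Consecutive u v xs
    go (_ ∷ _ ∷ _) here      fx≡fu fy≡fv with refl ← f-inj fx≡fu | refl ← f-inj fy≡fv = here
    go (_ ∷ xs)    (there c) fx≡fu fy≡fv = there (go xs c fx≡fu fy≡fv)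

  Adjacent-++⁺ˡ : ∀ ys → Adjacent u v xs → Adjacent u v (xs ++ ys)
  Adjacent-++⁺ˡ ys = Sum.map (Consecutive-++⁺ˡ ys) (Consecutive-++⁺ˡ ys)

  Adjacent-++⁺ʳ : ∀ xs → Adjacent u v ys → Adjacent u v (xs ++ ys)
  Adjacent-++⁺ʳ xs = Sum.map (Consecutive-++⁺ʳ xs) (Consecutive-++⁺ʳ xs)

  Adjacent-++⁻ : ∀ xs {ys} → Adjacent u v (xs ++ w ∷ ys) →
                 Adjacent u v (xs ++ [ w ]) ⊎ Adjacent u v (w ∷ ys)
  Adjacent-++⁻ xs (inj₁ c) = Sum.map inj₁ inj₁ (Consecutive-++⁻ xs c)
  Adjacent-++⁻ xs (inj₂ c) = Sum.map inj₂ inj₂ (Consecutive-++⁻ xs c)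

  Adjacent-map⁻ : {f : A → B} → (∀ {a b} → f a ≡ f b → a ≡ b) →
                  ∀ xs → Adjacent (f u) (f v) (map f xs) → Adjacent u v xs
  Adjacent-map⁻ f-inj xs = Sum.map (Consecutive-map⁻ f-inj xs) (Consecutive-map⁻ f-inj xs)

  Adjacent-∷⁻ : Adjacent u v (x ∷ xs) → u ≢ x → v ≢ x → Adjacent u v xs
  Adjacent-∷⁻ (inj₁ c) u≢x v≢x = inj₁ (Consecutive-∷⁻ c u≢x)
  Adjacent-∷⁻ (inj₂ c) u≢x v≢x = inj₂ (Consecutive-∷⁻ c v≢x)

  Adjacent-∷ʳ⁻ : ∀ xs → Adjacent u v (xs ++ [ x ]) → u ≢ x → v ≢ x → Adjacent u v xs
  Adjacent-∷ʳ⁻ xs (inj₁ c) u≢x v≢x = inj₁ (Consecutive-∷ʳ⁻ xs c v≢x)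
  Adjacent-∷ʳ⁻ xs (inj₂ c) u≢x v≢x = inj₂ (Consecutive-∷ʳ⁻ xs c u≢x)

  Adjacent-reverse⁺ : Adjacent u v xs → Adjacent u v (reverse xs)
  Adjacent-reverse⁺ = Sum.swap ∘ Sum.map Consecutive-reverse⁺ Consecutive-reverse⁺

  module _ {ℓ} {R : Rel A ℓ} where

    Linked-++⁻ : ∀ xs → Linked R (xs ++ w ∷ ys) → Linked R (xs ++ [ w ]) × Linked R (w ∷ ys)
    Linked-++⁻ []           l       = [-] , l
    Linked-++⁻ (x ∷ [])     (r ∷ l) = r ∷ [-] , l
    Linked-++⁻ (x ∷ y ∷ xs) (r ∷ l) = Product.map₁ (r ∷_) (Linked-++⁻ (y ∷ xs) l)

    Linked-++⁺ : ∀ xs → Linked R (xs ++ [ w ]) → Linked R (w ∷ ys) → Linked R (xs ++ w ∷ ys)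
    Linked-++⁺ []           _       l′ = l′
    Linked-++⁺ (x ∷ [])     (r ∷ _) l′ = r ∷ l′
    Linked-++⁺ (x ∷ y ∷ xs) (r ∷ l) l′ = r ∷ Linked-++⁺ (y ∷ xs) l l′

    Linked-∷ʳ⁻ : ∀ xs → Linked R (xs ++ [ w ]) → Linked R xs
    Linked-∷ʳ⁻ []           _       = []
    Linked-∷ʳ⁻ (x ∷ [])     _       = [-]
    Linked-∷ʳ⁻ (x ∷ y ∷ xs) (r ∷ l) = r ∷ Linked-∷ʳ⁻ (y ∷ xs) l

    Linked-∷ʳ⁺ : Linked R xs → last xs ≡ just v → R v w → Linked R (xs ++ [ w ])
    Linked-∷ʳ⁺ l end r =
      Linkedₚ.++⁺ l (subst (λ m → Connectedᵐ R m (just _)) (sym end) (just r)) [-]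

    Linked-∷ʳ⇒last : ∀ xs → Linked R (xs ++ [ w ]) → last xs ≡ just v → R v w
    Linked-∷ʳ⇒last (x ∷ [])     (r ∷ _) refl = r
    Linked-∷ʳ⇒last (x ∷ y ∷ xs) (_ ∷ l) end  = Linked-∷ʳ⇒last (y ∷ xs) l end

    Linked-reverse⁺ : Symmetric R → Linked R xs → Linked R (reverse xs)
    Linked-reverse⁺ sym-R []                     = []
    Linked-reverse⁺ sym-R [-]                    = [-]
    Linked-reverse⁺ sym-R (_∷_ {x} {y} {xs} r l) =
      subst (Linked R) (sym (reverse-++ (x ∷ y ∷ []) xs))
        (Linked-++⁺ (reverse xs) (subst (Linked R) (unfold-reverse y xs) (Linked-reverse⁺ sym-R l))
                    (sym-R r ∷ [-]))

  last-++ : ∀ xs → last (xs ++ y ∷ ys) ≡ last (y ∷ ys)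
  last-++ []            = refl
  last-++ (x ∷ [])      = refl
  last-++ (x ∷ x′ ∷ xs) = last-++ (x′ ∷ xs)

  Unique-∷ : x ∉ xs → Unique xs → Unique (x ∷ xs)
  Unique-∷ {xs = xs} x∉xs u = ¬Any⇒All¬ xs x∉xs ∷ u

  Unique-++⁻ˡ : ∀ xs → Unique (xs ++ ys) → Unique xs
  Unique-++⁻ˡ []       _       = []
  Unique-++⁻ˡ (x ∷ xs) (a ∷ u) = Allₚ.++⁻ˡ xs a ∷ Unique-++⁻ˡ xs u

  Unique-++⁻ʳ : ∀ xs → Unique (xs ++ ys) → Unique ys
  Unique-++⁻ʳ []       u       = u
  Unique-++⁻ʳ (x ∷ xs) (_ ∷ u) = Unique-++⁻ʳ xs u

  Unique-resp-↭ : xs ↭ ys → Unique xs → Unique ys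
  Unique-resp-↭ p = ↭ₛ.Unique-resp-↭ (setoid _) (↭⇒↭ₛ p)

  avoidTwo : {x y w : A} → DecidableEquality A → x ≢ y → x ≢ w → y ≢ w →
             ∀ (a b : A) → ∃ λ c → c ≢ a × c ≢ b
  avoidTwo {x = x} {y} {w} _≟_ x≢y x≢w y≢w a b with x ≟ a | x ≟ b | y ≟ a | y ≟ b
  ... | no x≢a   | no x≢b   | _        | _        = x , x≢a , x≢b
  ... | _        | _        | no y≢a   | no y≢b   = y , y≢a , y≢b
  ... | yes refl | _        | yes refl | _        = ⊥-elim (x≢y refl)
  ... | _        | yes refl | _        | yes refl = ⊥-elim (x≢y refl)
  ... | yes refl | _        | _        | yes refl = w , x≢w ∘ sym , y≢w ∘ sym
  ... | _        | yes refl | yes refl | _        = w , y≢w ∘ sym , x≢w ∘ sym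

  closed : List A → List A
  closed xs = xs ++ take 1 xs

  closed-map : ∀ (f : A → B) xs → closed (map f xs) ≡ map f (closed xs)
  closed-map f []       = refl
  closed-map f (x ∷ xs) = cong (f x ∷_) (sym (map-++ f xs [ x ]))

  ∈-closed⁻ : ∀ xs → w ∈ closed xs → w ∈ xs
  ∈-closed⁻ []       w∈ = w∈
  ∈-closed⁻ (x ∷ xs) w∈ with ∈-++⁻ (x ∷ xs) w∈
  ... | inj₁ w∈xs        = w∈xs
  ... | inj₂ (here refl) = here refl

open Lists

module _ {A : Set} (f : A → Bool) where

  countTrue : List A → ℕ
  countTrue xs = sum (map (λ x → if f x then 1 else 0) xs)

  1≤countTrue : ∀ {x xs} → x ∈ xs → f x ≡ true → 1 ≤ countTrue xs
  1≤countTrue {xs = y ∷ ys} (here refl) fx rewrite fx = s≤s z≤n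
  1≤countTrue {xs = y ∷ ys} (there x∈) fx with f y
  ... | true  = s≤s z≤n
  ... | false = 1≤countTrue x∈ fx

  2≤countTrue : ∀ {x y xs} → Unique xs → x ∈ xs → y ∈ xs → x ≢ y →
                f x ≡ true → f y ≡ true → 2 ≤ countTrue xs
  2≤countTrue _ (here refl) (here refl) x≢y _  _  = ⊥-elim (x≢y refl)
  2≤countTrue _ (here refl) (there y∈)  _   fx fy rewrite fx = s≤s (1≤countTrue y∈ fy)
  2≤countTrue _ (there x∈)  (here refl) _   fx fy rewrite fy = s≤s (1≤countTrue x∈ fx)
  2≤countTrue {xs = z ∷ zs} (_ ∷ u) (there x∈) (there y∈) x≢y fx fy =
    ≤-trans (2≤countTrue u x∈ y∈ x≢y fx fy) (m≤n+m (countTrue zs) (if f z then 1 else 0))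

deg1⇒uniqueNeighbour : ∀ (G : Graph) {v x y} → deg G v ≡ 1 → E G v x → E G v y → x ≡ y
deg1⇒uniqueNeighbour G {v} {x} {y} deg1 ex ey with x ≟ y
... | yes x≡y = x≡y
... | no  x≢y with s≤s () ← subst (2 ≤_) deg1
                   (2≤countTrue (Graph.adj G v) (allFin⁺ _) (∈-allFin x) (∈-allFin y) x≢y ex ey)

module Reachability (G : Graph) where

  open Graph G using (n; adj)
  open import Data.List.Membership.DecPropositional (_≟_ {n}) using (_∈?_)

  private variable
    X Y : V G → Set
    a b c : V G

  E-sym : E G a b → E G b a
  E-sym {a} {b} e = trans (Graph.sym G b a) e

  E-irrefl : E G a b → a ≢ b
  E-irrefl {a} e refl with () ← trans (sym e) (Graph.irrefl G a)

  reach-start : Reach G X a b → ¬ X a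
  reach-start (here ¬Xa)     = ¬Xa
  reach-start (step ¬Xa _ _) = ¬Xa

  reach-snoc : Reach G X a b → E G b c → ¬ X c → Reach G X a c
  reach-snoc (here ¬Xa)      e ¬Xc = step ¬Xa e (here ¬Xc)
  reach-snoc (step ¬Xa e′ r) e ¬Xc = step ¬Xa e′ (reach-snoc r e ¬Xc)

  reach-trans : Reach G X a b → Reach G X b c → Reach G X a c
  reach-trans (here _)       r′ = r′
  reach-trans (step ¬Xa e r) r′ = step ¬Xa e (reach-trans r r′)

  reach-sym : Reach G X a b → Reach G X b a
  reach-sym (here ¬Xa)     = here ¬Xa
  reach-sym (step ¬Xa e r) = reach-snoc (reach-sym r) (E-sym e) ¬Xa

  reach-mono : (∀ v → ¬ Y v → ¬ X v) → Reach G Y a b → Reach G X a b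
  reach-mono f (here ¬Ya)     = here (f _ ¬Ya)
  reach-mono f (step ¬Ya e r) = step (f _ ¬Ya) e (reach-mono f r)

  walk⇒path : Reach G X a b → ∃ λ vs → PathFromTo G a b vs × All (¬_ ∘ X) vs
  walk⇒path (here ¬Xa) = _ , (([-] , Unique-∷ (λ ()) []) , refl , refl) , ¬Xa ∷ []
  walk⇒path {a = a} (step ¬Xa e r) with walk⇒path r
  ... | vs@(_ ∷ _) , ((l , u) , refl , end) , av with a ∈? vs
  ...   | no a∉vs = a ∷ vs , ((e ∷ l , Unique-∷ a∉vs u) , refl , end) , ¬Xa ∷ av
  ...   | yes a∈vs with ys , zs , eq ← ∈-∃++ a∈vs =
    a ∷ zs ,
    ( (proj₂ (Linked-++⁻ ys (subst (Linked (E G)) eq l)) , Unique-++⁻ʳ ys (subst Unique eq u))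
    , refl , trans (sym (last-++ ys)) (trans (cong last (sym eq)) end) ) ,
    Allₚ.++⁻ʳ ys (subst (All _) eq av)

  path⇒walk : ∀ {vs} → PathFromTo G a b vs → Reach G (NoVertex G) a b
  path⇒walk {vs = _ ∷ ps} ((l , _) , refl , end) = go ps l end
    where
    go : ∀ {a} ps → Linked (E G) (a ∷ ps) → last (a ∷ ps) ≡ just b → Reach G (NoVertex G) a b
    go []       _       refl = here λ ()
    go (p ∷ ps) (e ∷ l) end  = step (λ ()) e (go ps l end)

  firstEntry : (C : List (V G)) → Reach G X a b → a ∉ C → b ∈ C →
               ∃₂ λ z y → Reach G (_∈ C) a z × E G z y × y ∈ C × ¬ X y
  firstEntry C (here _)             a∉C b∈C = ⊥-elim (a∉C b∈C)
  firstEntry C (step {b = c} _ e r) a∉C b∈C with c ∈? C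
  ... | yes c∈C = _ , c , here a∉C , e , c∈C , reach-start r
  ... | no  c∉C with z , y , r′ , e′ , y∈C , ¬Xy ← firstEntry C r c∉C b∈C =
    z , y , step a∉C e r′ , e′ , y∈C , ¬Xy

  private
    avoidOrLeave : Reach G X c b → b ≢ a →
                   Reach G (λ v → X v ⊎ v ≡ a) c b
                   ⊎ (∃ λ c′ → E G a c′ × Reach G (λ v → X v ⊎ v ≡ a) c′ b)
    avoidOrLeave (here ¬Xb) b≢a = inj₁ (here Sum.[ ¬Xb , b≢a ])
    avoidOrLeave {a = a} (step {a = c} {b = d} ¬Xc e r) b≢a with avoidOrLeave r b≢a
    ... | inj₂ leave = inj₂ leave
    ... | inj₁ r′ with c ≟ a
    ...   | yes refl = inj₂ (d , e , r′)
    ...   | no  c≢a  = inj₁ (step Sum.[ ¬Xc , c≢a ] e r′)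

  lastExit : Reach G X a b → a ≢ b → ∃ λ c → E G a c × Reach G (λ v → X v ⊎ v ≡ a) c b
  lastExit (here _)             a≢b = ⊥-elim (a≢b refl)
  lastExit (step {b = c} _ e r) a≢b with avoidOrLeave r (a≢b ∘ sym)
  ... | inj₁ r′    = c , e , r′
  ... | inj₂ leave = leave

  private
    E? : ∀ a b → Dec (E G a b)
    E? a b = adj a b Bool.≟ true

    _∖_ : List (V G) → V G → List (V G)
    xs ∖ a = filter (λ v → ¬? (v ≟ a)) xs

    ∈-∖⁻ : ∀ {v xs} → v ∈ xs ∖ a → v ∈ xs × v ≢ a
    ∈-∖⁻ = ∈-filter⁻ _

    ∉-∖⁻ : ∀ {v xs} → v ∉ xs ∖ a → v ∉ xs ⊎ v ≡ a
    ∉-∖⁻ {a} {v} {xs} v∉ with v ≟ a | v ∈? xs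
    ... | yes v≡a | _       = inj₂ v≡a
    ... | no  v≢a | yes v∈  = ⊥-elim (v∉ (∈-filter⁺ _ v∈ v≢a))
    ... | no  _   | no v∉xs = inj₁ v∉xs

  -- A walk from a to b ≠ a leaves a for the last time, so a can be dropped from
  -- the allowed vertices in the recursive call.
  reachWithin? : ∀ k (allowed : List (V G)) → length allowed ≤ k → ∀ a b →
                 Dec (Reach G (_∉ allowed) a b)
  reachWithin? k allowed len a b with a ∈? allowed | a ≟ b
  ... | no a∉  | _        = no λ r → reach-start r a∉
  ... | yes a∈ | yes refl = yes (here λ a∉ → a∉ a∈)
  reachWithin? zero    []      _   a b | yes () | no _
  reachWithin? (suc k) allowed len a b | yes a∈ | no a≢b
    with any? (λ c → E? a c ×-dec reachWithin? k (allowed ∖ a) shorter c b) (allFin n)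
    where
    shorter : length (allowed ∖ a) ≤ k
    shorter =
      ≤-pred (≤-trans (filter-notAll _ allowed (Any.map (λ a≡v v≢a → v≢a (sym a≡v)) a∈)) len)
  ... | yes found with c , e , r ← satisfied found =
    yes (step (λ a∉ → a∉ a∈) e
              (reach-mono (λ v v∈′ v∉ → v∈′ (v∉ ∘ proj₁ ∘ ∈-∖⁻)) r))
  ... | no none = no λ r → let c , e , r′ = lastExit r a≢b in
    none (Any.map (λ { refl → e , reach-mono (λ v ok v∉′ → ok (∉-∖⁻ v∉′)) r′ })
                  (∈-allFin c))

  reach? : ∀ w a b → Dec (Reach G (_≡ w) a b)
  reach? w a b with reachWithin? _ (allFin n ∖ w) ≤-refl a b
  ... | yes r =
    yes (reach-mono (λ v v∉ v≡w → v∉ λ v∈ → proj₂ (∈-∖⁻ {xs = allFin n} v∈) v≡w) r)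
  ... | no ¬r = no (¬r ∘ reach-mono λ v v≢w v∉ → v∉ (∈-filter⁺ _ (∈-allFin v) v≢w))

module Cycles (G : Graph) where

  open Reachability G using (E-sym)

  private variable
    u v p y : V G
    L Q C xs ys : List (V G)

  Cyclic : List (V G) → Set
  Cyclic L = Linked (E G) (closed L) × Unique L × 3 ≤ length L

  Through : V G → V G → List (V G) → Set
  Through u v L = Adjacent u v (closed L)

  closed-arcs : ∀ (y : V G) Q p C → closed (y ∷ Q ++ p ∷ C) ≡ y ∷ Q ++ p ∷ C ++ [ y ]
  closed-arcs y Q p C = cong (y ∷_) (++-assoc Q (p ∷ C) [ y ])

  arcs⁻ : Cyclic (y ∷ Q ++ p ∷ C) → Linked (E G) (y ∷ Q ++ [ p ]) × Linked (E G) (p ∷ C ++ [ y ])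
  arcs⁻ {y} {Q} {p} {C} (l , _) = Linked-++⁻ (y ∷ Q) (subst (Linked (E G)) (closed-arcs y Q p C) l)

  arcs⁺ : Linked (E G) (y ∷ Q ++ [ p ]) → Linked (E G) (p ∷ C ++ [ y ]) →
          Unique (y ∷ Q ++ p ∷ C) → 3 ≤ length (y ∷ Q ++ p ∷ C) → Cyclic (y ∷ Q ++ p ∷ C)
  arcs⁺ {y} {Q} {p} {C} l l′ u len =
    subst (Linked (E G)) (sym (closed-arcs y Q p C)) (Linked-++⁺ (y ∷ Q) l l′) , u , len

  Through-arcs⁻ : Through u v (y ∷ Q ++ p ∷ C) →
                  Adjacent u v (y ∷ Q ++ [ p ]) ⊎ Adjacent u v (p ∷ C ++ [ y ])
  Through-arcs⁻ {u} {v} {y} {Q} {p} {C} =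
    Adjacent-++⁻ (y ∷ Q) ∘ subst (Adjacent u v) (closed-arcs y Q p C)

  Through-arcs⁺ : Adjacent u v (y ∷ Q ++ [ p ]) ⊎ Adjacent u v (p ∷ C ++ [ y ]) →
                  Through u v (y ∷ Q ++ p ∷ C)
  Through-arcs⁺ {u} {v} {y} {Q} {p} {C} =
    subst (Adjacent u v) (sym (closed-arcs y Q p C)) ∘ Sum.[ firstArc , Adjacent-++⁺ʳ (y ∷ Q) ]
    where
    firstArc : Adjacent u v (y ∷ Q ++ [ p ]) → Adjacent u v (y ∷ Q ++ p ∷ C ++ [ y ])
    firstArc =
      subst (Adjacent u v) (cong (y ∷_) (++-assoc Q [ p ] (C ++ [ y ]))) ∘ Adjacent-++⁺ˡ (C ++ [ y ])

  rotate : Cyclic (y ∷ Q ++ p ∷ C) → Cyclic (p ∷ C ++ y ∷ Q)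
  rotate {y} {Q} {p} {C} cyc@(_ , u , len) with l , l′ ← arcs⁻ cyc =
    arcs⁺ l′ l (Unique-resp-↭ swap u) (subst (3 ≤_) (↭-length swap) len)
    where
    swap : y ∷ Q ++ p ∷ C ↭ p ∷ C ++ y ∷ Q
    swap = ++-comm (y ∷ Q) (p ∷ C)

  Through-rotate : Through u v (y ∷ Q ++ p ∷ C) → Through u v (p ∷ C ++ y ∷ Q)
  Through-rotate = Through-arcs⁺ ∘ Sum.swap ∘ Through-arcs⁻

  toFront : Cyclic L → p ∈ L →
            ∃ λ C → Cyclic (p ∷ C) × p ∷ C ↭ L
                  × (∀ {u v} → Through u v L → Through u v (p ∷ C))
  toFront cyc p∈L with ∈-∃++ p∈L
  ... | []    , C , refl = C , cyc , ↭-refl , id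
  ... | y ∷ Q , C , refl = C ++ y ∷ Q , rotate cyc , ++-comm (_ ∷ C) (y ∷ Q) , Through-rotate

  reverse-arc : ∀ (p : V G) xs y → reverse (p ∷ xs ++ [ y ]) ≡ y ∷ reverse xs ++ [ p ]
  reverse-arc p xs y = trans (unfold-reverse p (xs ++ [ y ])) (cong (_++ [ p ]) (reverse-++ xs [ y ]))

  -- y ∷ Q ++ [ p ] is the one of the two y–p arcs of the cycle that carries uv;
  -- R is the interior of the other arc.
  arcThrough : Cyclic (p ∷ xs ++ y ∷ ys) → Through u v (p ∷ xs ++ y ∷ ys) →
               ∃₂ λ Q R → Linked (E G) (y ∷ Q ++ [ p ]) × Adjacent u v (y ∷ Q ++ [ p ])
                        × (y ∷ Q ++ [ p ]) ++ R ↭ p ∷ xs ++ y ∷ ys × (Q ≡ ys ⊎ Q ≡ reverse xs)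
  arcThrough {p} {xs} {y} {ys} {u} {v} cyc thr with Through-arcs⁻ thr
  ... | inj₂ arc = ys , xs , proj₂ (arcs⁻ cyc) , arc , rotation , inj₁ refl
    where
    open PermutationReasoning
    rotation : (y ∷ ys ++ [ p ]) ++ xs ↭ p ∷ xs ++ y ∷ ys
    rotation = begin
      (y ∷ ys ++ [ p ]) ++ xs ≡⟨ cong (y ∷_) (++-assoc ys [ p ] xs) ⟩
      y ∷ ys ++ p ∷ xs        ↭⟨ ++-comm (y ∷ ys) (p ∷ xs) ⟩
      p ∷ xs ++ y ∷ ys        ∎
  ... | inj₁ arc = reverse xs , ys ,
      subst (Linked (E G)) (reverse-arc p xs y) (Linked-reverse⁺ E-sym (proj₁ (arcs⁻ cyc))) ,
      subst (Adjacent u v) (reverse-arc p xs y) (Adjacent-reverse⁺ arc) , reflection , inj₂ refl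
    where
    open PermutationReasoning
    reflection : (y ∷ reverse xs ++ [ p ]) ++ ys ↭ p ∷ xs ++ y ∷ ys
    reflection = begin
      (y ∷ reverse xs ++ [ p ]) ++ ys ≡⟨ cong (_++ ys) (reverse-arc p xs y) ⟨
      reverse (p ∷ xs ++ [ y ]) ++ ys ↭⟨ ++⁺ʳ ys (↭-reverse (p ∷ xs ++ [ y ])) ⟩
      (p ∷ xs ++ [ y ]) ++ ys         ≡⟨ cong (p ∷_) (++-assoc xs [ y ] ys) ⟩
      p ∷ xs ++ y ∷ ys                ∎

  length-arc : ∀ Q → 1 ≤ length Q → 3 ≤ length (y ∷ Q ++ [ p ])
  length-arc (_ ∷ [])    _ = s≤s (s≤s (s≤s z≤n))
  length-arc (_ ∷ _ ∷ _) _ = s≤s (s≤s (s≤s z≤n))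

  Through⇒∈ : Through u v L → u ∈ L × v ∈ L
  Through⇒∈ {L = L} =
    Product.map (∈-closed⁻ L) (∈-closed⁻ L)
    ∘ Sum.[ Consecutive⇒∈ , Product.swap ∘ Consecutive⇒∈ ]

  Cyclic⇒IsCycle : Cyclic L → IsCycle G L
  Cyclic⇒IsCycle {x ∷ xs} (l , u , len) =
    (Linked-∷ʳ⁻ (x ∷ xs) l , u) , len , λ { a b refl end → Linked-∷ʳ⇒last (x ∷ xs) l end }

  Adjacent⇒EdgeOfPath : Adjacent u v L → EdgeOfPath G u v L
  Adjacent⇒EdgeOfPath = Sum.map Consecutive⇒∃++ Consecutive⇒∃++

  Through⇒EdgeOfCycle : Through u v L → EdgeOfCycle G u v L
  Through⇒EdgeOfCycle = Adjacent⇒EdgeOfPath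

module Biconnected
    (G : Graph)
    (threeVertices : ∃₂ λ (x y : V G) → ∃ λ (z : V G) → x ≢ y × x ≢ z × y ≢ z)
    (noCutVertex : ∀ w a b → a ≢ w → b ≢ w → Reach G (_≡ w) a b)
    where

  open Graph G using (n)
  open Reachability G
  open Cycles G
  open import Data.List.Membership.DecPropositional (_≟_ {n}) using (_∈?_)

  private variable
    X : V G → Set
    a b c d p q u v : V G
    L C : List (V G)

  thirdVertex : ∀ u v → ∃ λ w → w ≢ u × w ≢ v
  thirdVertex = let x , y , z , x≢y , x≢z , y≢z = threeVertices in avoidTwo _≟_ x≢y x≢z y≢z

  otherNeighbour : E G u v → ∃ λ w → E G v w × w ≢ u
  otherNeighbour {u} {v} euv
    with w , w≢u , w≢v ← thirdVertex u v
    with noCutVertex u v w (E-irrefl euv ∘ sym) w≢u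
  ... | here _     = ⊥-elim (w≢v refl)
  ... | step _ e r = _ , e , reach-start r

  edgeOnCycle : E G a b → ∃ λ L → Cyclic L × Through a b L
  edgeOnCycle {a} {b} eab
    with w , ebw , w≢a ← otherNeighbour eab
    with walk⇒path (noCutVertex b a w (E-irrefl eab) (E-irrefl ebw ∘ sym))
  ... | _ ∷ []         , (_ , refl , refl) , _ = ⊥-elim (w≢a refl)
  ... | _ ∷ ps@(_ ∷ _) , ((l , u) , refl , end) , avoid =
    b ∷ a ∷ ps ,
    arcs⁺ {Q = []} (E-sym eab ∷ [-]) (Linked-∷ʳ⁺ l end (E-sym ebw))
          (Unique-∷ (λ b∈ → lookup avoid b∈ refl) u) (s≤s (s≤s (s≤s z≤n))) ,
    inj₂ here

  secondVertex : ∀ C → Cyclic (p ∷ C) → ∃ λ c → c ∈ C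
  secondVertex []      (_ , _ , s≤s ())
  secondVertex (c ∷ _) _ = c , here refl

  -- A vertex q outside the cycle, joined to p on it, is led back to the cycle
  -- by a path avoiding p; this ear replaces the arc not carrying uv.
  ear : Cyclic (p ∷ C) → Through u v (p ∷ C) → q ∉ p ∷ C → E G p q →
        ∃ λ L → Cyclic L × Through u v L × Through p q L
  ear {p} {C} {q = q} cyc@(_ , uniq , _) thr q∉ epq
    with c , c∈C ← secondVertex C cyc
    with z , y , walk , ezy , y∈ , y≢p
           ← firstEntry (p ∷ C)
               (noCutVertex p q c (q∉ ∘ here) λ { refl → Unique[x∷xs]⇒x∉xs uniq c∈C })
               q∉ (there c∈C)
    with y∈
  ... | here y≡p = ⊥-elim (y≢p y≡p)
  ... | there y∈C
    with xs , ys , refl ← ∈-∃++ y∈C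
    with Q , R , arc , arc-uv , arc↭ , _ ← arcThrough cyc thr
    with walk⇒path walk
  ... | _ ∷ ps , ((l , u) , refl , end) , avoid =
    y ∷ Q ++ p ∷ q ∷ ps ,
    arcs⁺ arc (epq ∷ Linked-∷ʳ⁺ l end ezy) unique
          (s≤s (≤-trans (s≤s (s≤s z≤n)) (length-++-≤ʳ (p ∷ q ∷ ps) {Q}))) ,
    Through-arcs⁺ (inj₁ arc-uv) , Through-arcs⁺ (inj₂ (inj₁ here))
    where
    onCycle : ∀ {w} → w ∈ y ∷ Q ++ [ p ] → w ∈ p ∷ xs ++ y ∷ ys
    onCycle = ∈-resp-↭ arc↭ ∘ ∈-++⁺ˡ
    unique : Unique (y ∷ Q ++ p ∷ q ∷ ps)
    unique = subst Unique (cong (y ∷_) (++-assoc Q [ p ] (q ∷ ps)))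
      (Uniqueₚ.++⁺ (Unique-++⁻ˡ (y ∷ Q ++ [ p ]) (Unique-resp-↭ (↭-sym arc↭) uniq)) u
                   (λ (w∈arc , w∈path) → lookup avoid w∈path (onCycle w∈arc)))

  cycleReaching : Cyclic L → Through u v L → q ∈ L → Reach G X q c →
                  ∃ λ L′ → Cyclic L′ × Through u v L′ × c ∈ L′
  cycleReaching cyc thr q∈ (here _) = _ , cyc , thr , q∈
  cycleReaching {L} cyc thr q∈ (step {b = q′} _ e r) with q′ ∈? L
  ... | yes q′∈ = cycleReaching cyc thr q′∈ r
  ... | no  q′∉
    with C , cyc′ , C↭L , toC ← toFront cyc q∈
    with L′ , cyc″ , thr′ , thr-qq′ ← ear cyc′ (toC thr) (q′∉ ∘ ∈-resp-↭ C↭L) e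
    = cycleReaching cyc″ thr′ (proj₂ (Through⇒∈ thr-qq′)) r

  chordOnCycle : Cyclic (c ∷ C) → Through u v (c ∷ C) → d ∈ C → E G c d →
                 ∃ λ L → Cyclic L × Through u v L × Through c d L
  chordOnCycle {c} {d = d} cyc@(_ , uniq , _) thr d∈C ecd with ∈-∃++ d∈C
  ... | []     , ys , refl = _ , cyc , thr , Through-arcs⁺ {Q = []} (inj₁ (inj₁ here))
  ... | xs     , [] , refl = _ , cyc , thr , Through-arcs⁺ {C = []} (inj₂ (inj₂ here))
  ... | x ∷ xs , y ∷ ys , refl
    with Q , R , arc , arc-uv , arc↭ , Q≡ ← arcThrough {xs = x ∷ xs} cyc thr =
    _ ,
    arcs⁺ arc (ecd ∷ [-]) (Unique-++⁻ˡ _ (Unique-resp-↭ (↭-sym arc↭) uniq))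
          (length-arc {y = d} {p = c} Q (nonempty Q≡)) ,
    Through-arcs⁺ (inj₁ arc-uv) , Through-arcs⁺ (inj₂ (inj₁ here))
    where
    nonempty : ∀ {Q} → Q ≡ y ∷ ys ⊎ Q ≡ reverse (x ∷ xs) → 1 ≤ length Q
    nonempty (inj₁ refl) = s≤s z≤n
    nonempty (inj₂ refl) = subst (1 ≤_) (sym (length-reverse (x ∷ xs))) (s≤s z≤n)

  incidentEdgeOnCycle : Cyclic L → Through u v L → c ∈ L → E G c d →
                        ∃ λ L′ → Cyclic L′ × Through u v L′ × Through c d L′
  incidentEdgeOnCycle {d = d} cyc thr c∈ ecd
    with C , cyc′ , _ , toC ← toFront cyc c∈
    with d ∈? C
  ... | yes d∈C = chordOnCycle cyc′ (toC thr) d∈C ecd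
  ... | no  d∉C =
    ear cyc′ (toC thr) (λ { (here refl) → E-irrefl ecd refl ; (there d∈C) → d∉C d∈C }) ecd

  twoEdgesOnCycle : E G a b → E G c d → ∃ λ L → Cyclic L × Through a b L × Through c d L
  twoEdgesOnCycle {a} {b} {c} eab ecd
    with L , cyc , thr ← edgeOnCycle eab
    with c ∈? L
  ... | yes c∈ = incidentEdgeOnCycle cyc thr c∈ ecd
  ... | no  c∉
    with a∈ , b∈ ← Through⇒∈ thr
    with L′ , cyc′ , thr′ , c∈′
           ← cycleReaching cyc thr a∈ (noCutVertex b a c (E-irrefl eab) λ { refl → c∉ b∈ })
    = incidentEdgeOnCycle cyc′ thr′ c∈′ ecd

module LeafApex (R : Graph) (skeleton : IsSkeleton R) where

  open Graph R using (n; adj)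
  open Labelled.SkeletonConditions (proj₂ (proj₂ (proj₂ skeleton)))
    using (connected; cutVertexCond; threePendant)
  open Reachability R

  isLeaf : V R → Bool
  isLeaf v = does (deg R v ≟ⁿ 1)

  isLeaf⇒deg1 : ∀ v → isLeaf v ≡ true → deg R v ≡ 1
  isLeaf⇒deg1 v = yes-witness (deg R v ≟ⁿ 1)
    where
    yes-witness : ∀ {A : Set} (a? : Dec A) → does a? ≡ true → A
    yes-witness (yes a) _ = a

  -- R⁺ is R with a new vertex zero joined to every leaf; vertex v of R becomes suc v.
  apexAdj : Fin (suc n) → Fin (suc n) → Bool
  apexAdj zero    zero    = false
  apexAdj zero    (suc v) = isLeaf v
  apexAdj (suc u) zero    = isLeaf u
  apexAdj (suc u) (suc v) = adj u v

  R⁺ : Graph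
  R⁺ = record
    { n      = suc n
    ; adj    = apexAdj
    ; sym    = λ { zero zero → refl ; zero (suc v) → refl ; (suc u) zero → refl
                 ; (suc u) (suc v) → Graph.sym R u v }
    ; irrefl = λ { zero → refl ; (suc v) → Graph.irrefl R v }
    }

  leafEdge : ∀ {l} → deg R l ≡ 1 → E R⁺ (suc l) zero
  leafEdge {l} = dec-true (deg R l ≟ⁿ 1)

  private variable
    X : V R → Set
    Y : V R⁺ → Set
    a b u v : V R

  private module R⁺-walks = Reachability R⁺

  liftWalk : (∀ v → ¬ X v → ¬ Y (suc v)) → Reach R X a b → Reach R⁺ Y (suc a) (suc b)
  liftWalk f (here ¬Xa)     = here (f _ ¬Xa)
  liftWalk f (step ¬Xa e r) = step (f _ ¬Xa) e (liftWalk f r)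

  liftAvoiding : ∀ {w} → Reach R (_≡ w) a b → Reach R⁺ (_≡ suc w) (suc a) (suc b)
  liftAvoiding = liftWalk λ v v≢w → v≢w ∘ suc-injective

  walkBetween : ∀ a b → Reach R (NoVertex R) a b
  walkBetween a b = path⇒walk (proj₂ (connected a b))

  pendantLeaf : Pendant R u v → ∃₂ λ l m → deg R l ≡ 1 × E R l m × SameEdge R l m u v
  pendantLeaf (e , inj₁ deg1) = _ , _ , deg1 , e , inj₁ (refl , refl)
  pendantLeaf (e , inj₂ deg1) = _ , _ , deg1 , E-sym e , inj₂ (refl , refl)

  twoLeaves : ∃₂ λ l₁ l₂ → deg R l₁ ≡ 1 × deg R l₂ ≡ 1 × l₁ ≢ l₂
  twoLeaves
    with _ , _ , _ , _ , _ , _ , pendant₁ , pendant₂ , _ , different , _ ← threePendant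
    with l₁ , m₁ , deg₁ , e₁ , same₁ ← pendantLeaf pendant₁
    with l₂ , m₂ , deg₂ , e₂ , same₂ ← pendantLeaf pendant₂
    = l₁ , l₂ , deg₁ , deg₂ ,
      λ { refl → different (sameEdge (deg1⇒uniqueNeighbour R deg₁ e₁ e₂) same₁ same₂) }
    where
    sameEdge : ∀ {l m m′ x y x′ y′ : V R} → m ≡ m′ →
               SameEdge R l m x y → SameEdge R l m′ x′ y′ → SameEdge R x y x′ y′
    sameEdge refl (inj₁ (refl , refl)) (inj₁ (refl , refl)) = inj₁ (refl , refl)
    sameEdge refl (inj₁ (refl , refl)) (inj₂ (refl , refl)) = inj₂ (refl , refl)
    sameEdge refl (inj₂ (refl , refl)) (inj₁ (refl , refl)) = inj₂ (refl , refl)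
    sameEdge refl (inj₂ (refl , refl)) (inj₂ (refl , refl)) = inj₁ (refl , refl)

  leafOtherThan : ∀ w → ∃ λ l → deg R l ≡ 1 × l ≢ w
  leafOtherThan w with l₁ , l₂ , deg₁ , deg₂ , l₁≢l₂ ← twoLeaves with l₁ ≟ w
  ... | yes refl = l₂ , deg₂ , l₁≢l₂ ∘ sym
  ... | no  l₁≢w = l₁ , deg₁ , l₁≢w

  -- Condition (iii) supplies the leaf when w separates a from l.
  reachApex : ∀ w a → a ≢ w → Reach R⁺ (_≡ suc w) (suc a) zero
  reachApex w a a≢w with l , deg1 , l≢w ← leafOtherThan w with reach? w a l
  ... | yes r = R⁺-walks.reach-snoc (liftAvoiding r) (leafEdge deg1) λ ()
  ... | no ¬r with v , r , deg1′ ← cutVertexCond w (a , l , a≢w , l≢w , walkBetween a l , ¬r) a a≢w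
    = R⁺-walks.reach-snoc (liftAvoiding r) (leafEdge deg1′) λ ()

  noCutVertex⁺ : ∀ w a b → a ≢ w → b ≢ w → Reach R⁺ (_≡ w) a b
  noCutVertex⁺ zero    zero    _       a≢w _   = ⊥-elim (a≢w refl)
  noCutVertex⁺ zero    (suc a) zero    _   b≢w = ⊥-elim (b≢w refl)
  noCutVertex⁺ zero    (suc a) (suc b) _   _   = liftWalk (λ _ _ ()) (walkBetween a b)
  noCutVertex⁺ (suc w) zero    zero    _   _   = here λ ()
  noCutVertex⁺ (suc w) zero    (suc b) _   b≢w = R⁺-walks.reach-sym (reachApex w b (b≢w ∘ cong suc))
  noCutVertex⁺ (suc w) (suc a) zero    a≢w _   = reachApex w a (a≢w ∘ cong suc)
  noCutVertex⁺ (suc w) (suc a) (suc b) a≢w b≢w =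
    R⁺-walks.reach-trans (reachApex w a (a≢w ∘ cong suc))
                         (R⁺-walks.reach-sym (reachApex w b (b≢w ∘ cong suc)))

  threeVertices⁺ : ∃₂ λ (x y : V R⁺) → ∃ λ (z : V R⁺) → x ≢ y × x ≢ z × y ≢ z
  threeVertices⁺ with l₁ , l₂ , _ , _ , l₁≢l₂ ← twoLeaves =
    zero , suc l₁ , suc l₂ , (λ ()) , (λ ()) , l₁≢l₂ ∘ suc-injective

  private
    module C  = Cycles R
    module C⁺ = Cycles R⁺
  open import Data.List.Membership.DecPropositional (_≟_ {suc n}) using (_∈?_)

  unsuc : ∀ (L : List (V R⁺)) → zero ∉ L → ∃ λ K → L ≡ map suc K
  unsuc []          _     = [] , refl
  unsuc (zero ∷ L)  zero∉ = ⊥-elim (zero∉ (here refl))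
  unsuc (suc v ∷ L) zero∉ with K , refl ← unsuc L (zero∉ ∘ there) = v ∷ K , refl

  cycleWithoutApex : ∀ K → C⁺.Cyclic (map suc K) → C.Cyclic K
  cycleWithoutApex K (l , u , len) =
    Linkedₚ.map⁻ (subst (Linked (E R⁺)) (closed-map suc K) l) , Uniqueₚ.map⁻ u ,
    subst (3 ≤_) (length-map suc K) len

  Through-withoutApex : ∀ K → C⁺.Through (suc u) (suc v) (map suc K) → C.Through u v K
  Through-withoutApex K = Adjacent-map⁻ suc-injective (closed K) ∘ subst (Adjacent _ _) (closed-map suc K)

  headIsLeaf : ∀ K → Linked (E R⁺) (zero ∷ map suc K) → ∀ a → head K ≡ just a → deg R a ≡ 1
  headIsLeaf (k ∷ _) (e ∷ _) _ refl = isLeaf⇒deg1 k e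

  lastIsLeaf : ∀ K → Linked (E R⁺) (map suc K ++ [ zero ]) →
               ∀ b → last K ≡ just b → deg R b ≡ 1
  lastIsLeaf K l b end =
    isLeaf⇒deg1 b (Linked-∷ʳ⇒last (map suc K) l (trans (last-map suc K) (cong (Maybe.map suc) end)))

  leafPath : ∀ K → C⁺.Cyclic (zero ∷ map suc K) →
             IsPath R K × (∀ a → head K ≡ just a → deg R a ≡ 1)
                        × (∀ b → last K ≡ just b → deg R b ≡ 1)
  leafPath K (l , _ ∷ u , _) =
    (Linkedₚ.map⁻ (Linked-∷ʳ⁻ (map suc K) (Linked.tail l)) , Uniqueₚ.map⁻ u) ,
    headIsLeaf K (Linked-∷ʳ⁻ (zero ∷ map suc K) l) , lastIsLeaf K (Linked.tail l)

  Through-leafPath : ∀ K → C⁺.Through (suc u) (suc v) (zero ∷ map suc K) → Adjacent u v K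
  Through-leafPath K thr =
    Adjacent-map⁻ suc-injective K
      (Adjacent-∷ʳ⁻ (map suc K) (Adjacent-∷⁻ thr (λ ()) (λ ())) (λ ()) (λ ()))

  CycleOrLeafPath : V R → V R → V R → V R → Set
  CycleOrLeafPath u₁ v₁ u₂ v₂ =
      (∃ λ vs → IsCycle R vs × EdgeOfCycle R u₁ v₁ vs × EdgeOfCycle R u₂ v₂ vs)
    ⊎ (∃ λ vs → IsPath R vs
         × (∀ a → head vs ≡ just a → deg R a ≡ 1)
         × (∀ b → last vs ≡ just b → deg R b ≡ 1)
         × EdgeOfPath R u₁ v₁ vs × EdgeOfPath R u₂ v₂ vs)

  cycleOrLeafPath : ∀ {u₁ v₁ u₂ v₂} →
                    (∃ λ L → C⁺.Cyclic L × C⁺.Through (suc u₁) (suc v₁) L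
                                         × C⁺.Through (suc u₂) (suc v₂) L) →
                    CycleOrLeafPath u₁ v₁ u₂ v₂
  cycleOrLeafPath (L , cyc , thr₁ , thr₂) with zero ∈? L
  ... | no apex∉L with K , refl ← unsuc L apex∉L =
    inj₁ (K , C.Cyclic⇒IsCycle (cycleWithoutApex K cyc) ,
          C.Through⇒EdgeOfCycle {L = K} (Through-withoutApex K thr₁) ,
          C.Through⇒EdgeOfCycle {L = K} (Through-withoutApex K thr₂))
  ... | yes apex∈L
    with C , cyc′ , _ , toC ← C⁺.toFront cyc apex∈L
    with K , refl ← unsuc C (Unique[x∷xs]⇒x∉xs (proj₁ (proj₂ cyc′)))
    with path , headLeaf , lastLeaf ← leafPath K cyc′ =
    inj₂ (K , path , headLeaf , lastLeaf ,
          C.Adjacent⇒EdgeOfPath (Through-leafPath K (toC thr₁)) ,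
          C.Adjacent⇒EdgeOfPath (Through-leafPath K (toC thr₂)))

lemma3p4 : (R : Graph) → IsSkeleton R →
    ∀ u₁ v₁ u₂ v₂ → E R u₁ v₁ → E R u₂ v₂ →
      (∃ λ vs → IsCycle R vs × EdgeOfCycle R u₁ v₁ vs × EdgeOfCycle R u₂ v₂ vs)
    ⊎ (∃ λ vs → IsPath R vs
         × (∀ a → head vs ≡ just a → deg R a ≡ 1)
         × (∀ b → last vs ≡ just b → deg R b ≡ 1)
         × EdgeOfPath R u₁ v₁ vs × EdgeOfPath R u₂ v₂ vs)
lemma3p4 R skeleton u₁ v₁ u₂ v₂ e₁ e₂ = cycleOrLeafPath (twoEdgesOnCycle e₁ e₂)
  where
  open LeafApex R skeleton
  open Biconnected R⁺ threeVertices⁺ noCutVertex⁺
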